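{- Let $m$ be a positive integer, $q=2^m$, and let $f(x)$ be an o-polynomial over $\mathrm{GF}(q)$ such that $|\mathcal{B}_{(f,q/2)}|=(q-1)q$. Then $\mathbf{D}(f,q/2)=(\mathrm{GF}(q),\mathcal{B}_{(f,q/2)})$ is a $2$-$\left(q,\ q/2,\ q(q-2)/4\right)$ design.
   Context: For a prime power $q$ and a polynomial $f$ over $\mathrm{GF}(q)$ (viewed as a function $\mathrm{GF}(q)\to\mathrm{GF}(q)$), for $(b,c)\in\mathrm{GF}(q)^2$ put $B_{(f,b,c)}=\{f(x)+bx+c: x\in \mathrm{GF}(q)\}$. For an integer $k$ with $2\le k\le q$, $\mathcal{B}_{(f,k)}=\{B_{(f,b,c)}: |B_{(f,b,c)}|=k,\ b,c\in\mathrm{GF}(q)\}$ (a set, so each block appears once), and $\mathbf{D}(f,k)$ is the incidence structure with point set $\mathrm{GF}(q)$, block set $\mathcal{B}_{(f,k)}$ and incidence given by membership. A $t$-$(v,k,\lambda)$ design is a pair $(\mathcal{P},\mathcal{B})$ with $|\mathcal{P}|=v$ and $\mathcal{B}$ a set of $k$-subsets of $\mathcal{P}$ such that every $t$-subset of $\mathcal{P}$ is contained in exactly $\lambda$ members of $\mathcal{B}$. With $q=2^m$, an o-polynomial over $\mathrm{GF}(q)$ is a polynomial $f\in\mathrm{GF}(q)[x]$ with $\deg f<q$, $f(0)=0$, $f$ a permutation of $\mathrm{GF}(q)$, and such that for every $a\in\mathrm{GF}(q)$ the polynomial $(f(x+a)+f(a))x^{q-2}$ is also a permutation of $\mathrm{GF}(q)$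 (the normalization $f(1)=1$ is not required). -}

module Defs where

open import Level using (0ℓ)
open import Data.Nat as ℕ using (ℕ; zero; suc)
open import Data.Fin using (Fin)
open import Data.Fin.Subset using (Subset; ⁅_⁆; ⋃; _⊆_; ∣_∣)
open import Data.Fin.Subset.Properties using (_⊆?_)
open import Data.Bool.Properties renaming (_≟_ to _≟ᵇ_)
open import Data.Vec using (Vec)
import Data.Vec as Vec
open import Data.Vec.Properties using (≡-dec)
open import Data.List using (List; map; filter; length; cartesianProduct; allFin; deduplicate)
open import Data.List.Relation.Unary.All using (All)
open import Data.List.Relation.Unary.Unique.Propositional using (Unique)
open import Data.Product using (_×_; _,_; ∃)
open import Relation.Binary.PropositionalEquality using (_≡_; _≢_)
open import Relation.Nullary using (¬_)
open import Algebra.Structures using (IsCommutativeRing)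
open import Function.Bundles using (_↔_; Inverse)
open import Function.Definitions using (Bijective)

record FiniteField (q : ℕ) : Set₁ where
  infixl 6 _+_
  infixl 7 _*_
  field
    Carrier : Set
    _+_ _*_ : Carrier → Carrier → Carrier
    -_      : Carrier → Carrier
    0# 1#   : Carrier
    isCommutativeRing : IsCommutativeRing _≡_ _+_ _*_ -_ 0# 1#
    0≢1     : 0# ≢ 1#
    inverse : ∀ x → x ≢ 0# → ∃ λ y → x * y ≡ 1#
    enum    : Fin q ↔ Carrier

  index : Carrier → Fin q
  index = Inverse.from enum

  elems : List Carrier
  elems = map (Inverse.to enum) (allFin q)

  _^_ : Carrier → ℕ → Carrier
  x ^ zero  = 1#
  x ^ suc n = x * (x ^ n)

  -- a polynomial of degree < q, given by its coefficient vector
  -- (c₀ , c₁ , … , c_{q-1}), evaluated as Σ cᵢ xⁱ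
  Poly : Set
  Poly = Vec Carrier q

  eval : Poly → Carrier → Carrier
  eval cs x = Vec.foldr (λ _ → Carrier) (λ c acc → c + x * acc) 0# cs

  IsOPolynomial : Poly → Set
  IsOPolynomial f =
    eval f 0# ≡ 0#
    × Bijective _≡_ _≡_ (eval f)
    × (∀ a → Bijective _≡_ _≡_ (λ x → (eval f (x + a) + eval f a) * (x ^ (q ℕ.∸ 2))))

  block : Poly → Carrier → Carrier → Subset q
  block f b c = ⋃ (map (λ x → ⁅ index (eval f x + b * x + c) ⁆) elems)

  -- 𝓑_(f,k): the SET of blocks B_(f,b,c) of size k (duplicates removed)
  blocks : Poly → ℕ → List (Subset q)
  blocks f k =
    deduplicate (≡-dec _≟ᵇ_)
      (filter (λ B → ∣ B ∣ ℕ.≟ k)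
        (map (λ bc → block f (Data.Product.proj₁ bc) (Data.Product.proj₂ bc))
             (cartesianProduct elems elems)))

IsDesign : (t v k r : ℕ) → List (Subset v) → Set
IsDesign t v k r 𝓑 =
  Unique 𝓑
  × All (λ B → ∣ B ∣ ≡ k) 𝓑
  × (∀ (T : Subset v) → ∣ T ∣ ≡ t → length (filter (T ⊆?_) 𝓑) ≡ r)

module Submission where

-- Write g b x = f x + b x. The o-polynomial condition says that for
-- every a the chord slope z ↦ (f (z + a) + f a) / z is a permutation, so for
-- b ≠ 0 every value of g b is taken exactly twice (OPoly). Counting the hits
-- of x ↦ g b x + c then gives |B(b, c)| = q / 2 for b ≠ 0, while B(0, c) is
-- the whole field (Blocks); so exactly the q (q - 1) blocks with b ≠ 0 have
-- size q / 2, and the hypothesis says they are pairwise distinct. For points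
-- u ≠ v the number Λ of these blocks through both satisfies
-- 4 Λ = Σ_{b ≠ 0, c} hits(u) hits(v), and summing first over c, then over b,
-- this counts the pairs x ≠ y with f x + f y ≠ u + v, i.e. q (q - 2)
-- (PairCount, Design).

open import Defs
open import Data.Nat as ℕ using (ℕ; zero; suc)
open import Data.Fin using (Fin)
open import Relation.Binary.PropositionalEquality using (_≢_)


module Counting where

  open import Data.Nat using (_+_; _*_)
  open import Data.Nat.Properties using (+-*-semiring; *-zeroʳ; ≤-antisym; ≤-trans; ≤-reflexive; suc-injective)
  open import Data.Fin as Fin using (zero; suc)
  import Data.Fin.Properties as Finₚ
  open import Data.List using (List; []; _∷_; length; filter; tabulate; map; cartesianProduct; deduplicate; _++_)
  import Data.List.Properties as Listₚ
  open import Data.Product using (_×_; _,_)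
  open import Data.Sum using (_⊎_)
  open import Data.Empty using (⊥-elim)
  open import Level using (0ℓ)
  open import Relation.Nullary using (¬_; Dec; yes; no; ¬?)
  open import Relation.Nullary.Decidable using (_×-dec_)
  open import Relation.Unary using (Pred; Decidable)
  open import Relation.Binary using (DecidableEquality)
  open import Relation.Binary.PropositionalEquality
  open import Function using (_∘_)
  open import Algebra.Properties.Semiring.Sum +-*-semiring public
    using (sum; sum-cong-≗; ∑-distrib-+; ∑-comm; *-distribˡ-sum; *-distribʳ-sum)

  𝟙 : ∀ {a} {A : Set a} → Dec A → ℕ
  𝟙 (yes _) = 1
  𝟙 (no _)  = 0

  𝟙-yes : ∀ {a} {A : Set a} (d : Dec A) → A → 𝟙 d ≡ 1
  𝟙-yes (yes _) _ = refl
  𝟙-yes (no ¬a) a = ⊥-elim (¬a a)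

  𝟙-no : ∀ {a} {A : Set a} (d : Dec A) → ¬ A → 𝟙 d ≡ 0
  𝟙-no (yes a) ¬a = ⊥-elim (¬a a)
  𝟙-no (no _)  _  = refl

  𝟙-cong : ∀ {a b} {A : Set a} {B : Set b} (d : Dec A) (e : Dec B) →
    (A → B) → (B → A) → 𝟙 d ≡ 𝟙 e
  𝟙-cong (yes a) e to from = sym (𝟙-yes e (to a))
  𝟙-cong (no ¬a) e to from = sym (𝟙-no e (¬a ∘ from))

  𝟙-× : ∀ {a b} {A : Set a} {B : Set b} (d : Dec A) (e : Dec B) → 𝟙 (d ×-dec e) ≡ 𝟙 d * 𝟙 e
  𝟙-× (yes _) (yes _) = refl
  𝟙-× (yes _) (no _)  = refl
  𝟙-× (no _)  (yes _) = refl
  𝟙-× (no _)  (no _)  = refl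

  𝟙-⊎ : ∀ {x a b} {X : Set x} {A : Set a} {B : Set b} (d : Dec X) (dA : Dec A) (dB : Dec B) →
    (X → A ⊎ B) → (A → X) → (B → X) → (A → ¬ B) → 𝟙 d ≡ 𝟙 dA + 𝟙 dB
  𝟙-⊎ d (yes a) dB split fromA fromB disjoint =
    trans (𝟙-yes d (fromA a)) (cong suc (sym (𝟙-no dB (disjoint a))))
  𝟙-⊎ d (no ¬a) (yes b) split fromA fromB disjoint = 𝟙-yes d (fromB b)
  𝟙-⊎ d (no ¬a) (no ¬b) split fromA fromB disjoint =
    𝟙-no d (λ x → Data.Sum.[ ¬a , ¬b ] (split x))

  sum-const : ∀ n k → sum {n} (λ _ → k) ≡ n * k
  sum-const zero    k = refl
  sum-const (suc n) k = cong (k +_) (sum-const n k)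

  sum-delta : ∀ {n} (j : Fin n) → sum (λ i → 𝟙 (i Fin.≟ j)) ≡ 1
  sum-delta {suc n} zero =
    cong suc (trans (sum-cong-≗ {n} (λ i → 𝟙-no (suc i Fin.≟ zero) (λ ()))) (trans (sum-const n 0) (*-zeroʳ n)))
  sum-delta {suc n} (suc j) =
    trans (sum-cong-≗ (λ i → 𝟙-cong (suc i Fin.≟ suc j) (i Fin.≟ j) Finₚ.suc-injective (cong suc))) (sum-delta j)

  length-filter-tabulate : ∀ {a p} {A : Set a} {P : Pred A p} (P? : Decidable P) {n} (h : Fin n → A) →
    length (filter P? (tabulate h)) ≡ sum (λ i → 𝟙 (P? (h i)))
  length-filter-tabulate P? {zero}  h = refl
  length-filter-tabulate P? {suc n} h with P? (h zero)
  ... | yes _ = cong suc (length-filter-tabulate P? (h ∘ suc))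
  ... | no _  = length-filter-tabulate P? (h ∘ suc)

  length-filter-product : ∀ {A B X : Set} {P : Pred X 0ℓ} (P? : Decidable P) (H : A × B → X)
    {n n′} (h₁ : Fin n → A) (h₂ : Fin n′ → B) →
    length (filter P? (map H (cartesianProduct (tabulate h₁) (tabulate h₂)))) ≡
    sum (λ i → sum (λ j → 𝟙 (P? (H (h₁ i , h₂ j)))))
  length-filter-product P? H {zero}  h₁ h₂ = refl
  length-filter-product {A} {B} P? H {suc n} h₁ h₂ = begin
    length (filter P? (map H (row ++ rest)))
      ≡⟨ cong (length ∘ filter P?) (Listₚ.map-++ H row rest) ⟩
    length (filter P? (map H row ++ map H rest))
      ≡⟨ cong length (Listₚ.filter-++ P? (map H row) (map H rest)) ⟩
    length (filter P? (map H row) ++ filter P? (map H rest))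
      ≡⟨ Listₚ.length-++ (filter P? (map H row)) ⟩
    length (filter P? (map H row)) + length (filter P? (map H rest))
      ≡⟨ cong₂ _+_ rowCount (length-filter-product P? H (h₁ ∘ suc) h₂) ⟩
    sum (λ j → 𝟙 (P? (H (h₁ zero , h₂ j)))) + sum (λ i → sum (λ j → 𝟙 (P? (H (h₁ (suc i) , h₂ j))))) ∎
    where
    open ≡-Reasoning
    row : List (A × B)
    row = map (h₁ zero ,_) (tabulate h₂)
    rest : List (A × B)
    rest = cartesianProduct (tabulate (h₁ ∘ suc)) (tabulate h₂)
    rowCount : length (filter P? (map H row)) ≡ sum (λ j → 𝟙 (P? (H (h₁ zero , h₂ j))))
    rowCount = trans (cong (length ∘ filter P? ∘ map H) (Listₚ.map-tabulate h₂ (h₁ zero ,_)))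
      (trans (cong (length ∘ filter P?) (Listₚ.map-tabulate (λ j → h₁ zero , h₂ j) H))
        (length-filter-tabulate P? (λ j → H (h₁ zero , h₂ j))))

  length-filter-filter : ∀ {X : Set} {P Q : Pred X 0ℓ} (P? : Decidable P) (Q? : Decidable Q) (xs : List X) →
    length (filter Q? (filter P? xs)) ≡ length (filter (λ x → P? x ×-dec Q? x) xs)
  length-filter-filter P? Q? [] = refl
  length-filter-filter P? Q? (x ∷ xs) with P? x
  ... | no _  = length-filter-filter P? Q? xs
  ... | yes _ with Q? x
  ...   | yes _ = cong suc (length-filter-filter P? Q? xs)
  ...   | no _  = length-filter-filter P? Q? xs

  deduplicate-complete : ∀ {X : Set} (R? : DecidableEquality X) (xs : List X) →
    length (deduplicate R? xs) ≡ length xs → deduplicate R? xs ≡ xs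
  deduplicate-complete R? [] eq = refl
  deduplicate-complete R? (x ∷ xs) eq =
    cong (x ∷_) (trans (Listₚ.filter-complete (¬? ∘ R? x) (trans eq′ (sym restEq)))
                       (deduplicate-complete R? xs restEq))
    where
    eq′ : length (filter (¬? ∘ R? x) (deduplicate R? xs)) ≡ length xs
    eq′ = suc-injective eq
    restEq : length (deduplicate R? xs) ≡ length xs
    restEq = ≤-antisym (Listₚ.length-deduplicate R? xs)
      (≤-trans (≤-reflexive (sym eq′)) (Listₚ.length-filter (¬? ∘ R? x) (deduplicate R? xs)))

module Subsets where

  open import Data.Nat using (_*_)
  open import Data.Nat.Properties using (suc-injective)
  open import Data.Fin using (zero; suc)
  import Data.Fin.Properties as Finₚ
  open import Data.Fin.Subset using (Subset; ⁅_⁆; ⋃; ∣_∣; _∈_; _∉_; inside; outside)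
  open import Data.Fin.Subset.Properties using (_⊆?_; _∈?_; x∈p∪q⁻; x∈p∪q⁺; x∈⁅y⁆⇒x≡y; x∈⁅x⁆; ∉⊥)
  open import Data.Vec using ([]; _∷_; here; there)
  open import Data.List using (List; []; _∷_; map; tabulate)
  open import Data.Product using (∃; ∃₂; _×_; _,_)
  open import Data.Sum using (_⊎_; inj₁; inj₂; [_,_])
  import Data.Sum as Sum
  open import Data.Empty using (⊥-elim)
  open import Relation.Nullary using (¬_)
  open import Relation.Nullary.Decidable using (_×-dec_)
  open import Relation.Binary.PropositionalEquality hiding ([_])
  open import Function using (_∘_)
  open Counting

  ∣∣-sum : ∀ {n} (p : Subset n) → ∣ p ∣ ≡ sum (λ i → 𝟙 (i ∈? p))
  ∣∣-sum []            = refl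
  ∣∣-sum (inside ∷ p)  = cong suc (trans (∣∣-sum p) (sum-cong-≗ (λ i → 𝟙-cong (i ∈? p) (suc i ∈? (inside ∷ p)) there (λ { (there x) → x }))))
  ∣∣-sum (outside ∷ p) = trans (∣∣-sum p) (sum-cong-≗ (λ i → 𝟙-cong (i ∈? p) (suc i ∈? (outside ∷ p)) there (λ { (there x) → x })))

  ∣∣≡0⇒empty : ∀ {n} (T : Subset n) → ∣ T ∣ ≡ 0 → ∀ x → x ∉ T
  ∣∣≡0⇒empty (outside ∷ T) eq (suc x) (there x∈T) = ∣∣≡0⇒empty T eq x x∈T

  ∣∣≡1⇒singleton : ∀ {n} (T : Subset n) → ∣ T ∣ ≡ 1 → ∃ λ i → i ∈ T × (∀ x → x ∈ T → x ≡ i)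
  ∣∣≡1⇒singleton (inside ∷ T) eq =
    zero , here , λ { zero _ → refl ; (suc x) (there x∈T) → ⊥-elim (∣∣≡0⇒empty T (suc-injective eq) x x∈T) }
  ∣∣≡1⇒singleton (outside ∷ T) eq with ∣∣≡1⇒singleton T eq
  ... | i , i∈T , only-i = suc i , there i∈T , λ { (suc x) (there x∈T) → cong suc (only-i x x∈T) }

  ∣∣≡2⇒pair : ∀ {n} (T : Subset n) → ∣ T ∣ ≡ 2 →
    ∃₂ λ i j → i ≢ j × i ∈ T × j ∈ T × (∀ x → x ∈ T → x ≡ i ⊎ x ≡ j)
  ∣∣≡2⇒pair (inside ∷ T) eq with ∣∣≡1⇒singleton T (suc-injective eq)
  ... | j , j∈T , only-j = zero , suc j , (λ ()) , here , there j∈T ,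
    λ { zero _ → inj₁ refl ; (suc x) (there x∈T) → inj₂ (cong suc (only-j x x∈T)) }
  ∣∣≡2⇒pair (outside ∷ T) eq with ∣∣≡2⇒pair T eq
  ... | i , j , i≢j , i∈T , j∈T , only-ij = suc i , suc j , i≢j ∘ Finₚ.suc-injective , there i∈T , there j∈T ,
    λ { (suc x) (there x∈T) → Sum.map (cong suc) (cong suc) (only-ij x x∈T) }

  𝟙-pair⊆ : ∀ {n} {T B : Subset n} {i j : Fin n} → i ∈ T → j ∈ T → (∀ x → x ∈ T → x ≡ i ⊎ x ≡ j) →
    𝟙 (T ⊆? B) ≡ 𝟙 (i ∈? B) * 𝟙 (j ∈? B)
  𝟙-pair⊆ {T = T} {B} {i} {j} i∈T j∈T only-ij =
    trans (𝟙-cong (T ⊆? B) ((i ∈? B) ×-dec (j ∈? B)) (λ T⊆B → T⊆B i∈T , T⊆B j∈T) both⇒⊆)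
          (𝟙-× (i ∈? B) (j ∈? B))
    where
    both⇒⊆ : i ∈ B × j ∈ B → ∀ {x} → x ∈ T → x ∈ B
    both⇒⊆ (i∈B , j∈B) {x} x∈T = [ (λ x≡i → subst (_∈ B) (sym x≡i) i∈B) , (λ x≡j → subst (_∈ B) (sym x≡j) j∈B) ] (only-ij x x∈T)

  module _ {A : Set} {n : ℕ} (G : A → Fin n) where

    ∈-image⁻ : ∀ (xs : List A) {i} → i ∈ ⋃ (map (λ x → ⁅ G x ⁆) xs) → ∃ λ x → G x ≡ i
    ∈-image⁻ [] i∈ = ⊥-elim (∉⊥ i∈)
    ∈-image⁻ (x ∷ xs) i∈ with x∈p∪q⁻ ⁅ G x ⁆ (⋃ (map (λ x → ⁅ G x ⁆) xs)) i∈
    ... | inj₁ i∈⁅Gx⁆ = x , sym (x∈⁅y⁆⇒x≡y _ i∈⁅Gx⁆)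
    ... | inj₂ i∈rest = ∈-image⁻ xs i∈rest

    ∈-image⁺ : ∀ {k} (h : Fin k → A) {i} (j : Fin k) → G (h j) ≡ i → i ∈ ⋃ (map (λ x → ⁅ G x ⁆) (tabulate h))
    ∈-image⁺ h zero    eq = x∈p∪q⁺ (inj₁ (subst (_∈ ⁅ G (h zero) ⁆) eq (x∈⁅x⁆ _)))
    ∈-image⁺ h (suc j) eq = x∈p∪q⁺ {p = ⁅ G (h zero) ⁆} (inj₂ (∈-image⁺ (h ∘ suc) j eq))

module FieldFacts {q : ℕ} (F : FiniteField q) where

  import Data.Nat.Properties as ℕₚ
  open import Level using (0ℓ)
  open import Data.Fin as Fin using (zero; suc)
  import Data.Fin.Properties as Finₚ
  open import Data.Product using (proj₁; proj₂)
  open import Data.Empty using (⊥-elim)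
  open import Relation.Nullary using (Dec; yes; no)
  open import Relation.Binary using (DecidableEquality)
  open import Relation.Binary.PropositionalEquality
  open import Function using (_∘_; id)
  open import Function.Bundles using (Inverse)
  open import Algebra.Bundles using (CommutativeMonoid)
  open import Algebra.Structures using (IsCommutativeRing; IsCommutativeMonoid)
  open import Data.Fin.Permutation using (Permutation; permutation)
  import Algebra.Properties.CommutativeMonoid.Sum as MonoidSum
  open Counting

  open FiniteField F public
  open IsCommutativeRing isCommutativeRing public
    using (+-assoc; +-comm; +-identityˡ; +-identityʳ; -‿inverseʳ; *-assoc; *-comm;
           *-identityˡ; *-identityʳ; distribˡ; distribʳ; zeroˡ; zeroʳ)
  open IsCommutativeRing isCommutativeRing using (+-isCommutativeMonoid; *-isCommutativeMonoid)
  open import Algebra.Properties.CommutativeSemigroup using (interchange)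
  open ≡-Reasoning

  element : Fin q → Carrier
  element = Inverse.to enum

  element-index : ∀ x → element (index x) ≡ x
  element-index = Inverse.strictlyInverseˡ enum

  index-element : ∀ i → index (element i) ≡ i
  index-element = Inverse.strictlyInverseʳ enum

  index-injective : ∀ {x y} → index x ≡ index y → x ≡ y
  index-injective {x} {y} eq = trans (sym (element-index x)) (trans (cong element eq) (element-index y))

  infix 4 _≟_
  _≟_ : DecidableEquality Carrier
  x ≟ y with index x Fin.≟ index y
  ... | yes eq = yes (index-injective eq)
  ... | no neq = no (neq ∘ cong index)

  ∑ : (Carrier → ℕ) → ℕ
  ∑ g = sum (g ∘ element)

  ∑-delta : ∀ a → ∑ (λ x → 𝟙 (x ≟ a)) ≡ 1
  ∑-delta a = trans (sum-cong-≗ pointwise) (sum-delta (index a))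
    where
    pointwise : ∀ i → 𝟙 (element i ≟ a) ≡ 𝟙 (i Fin.≟ index a)
    pointwise i = 𝟙-cong _ _ (λ eq → trans (sym (index-element i)) (cong index eq))
                             (λ eq → index-injective (trans (index-element i) eq))

  ∑-delta-* : ∀ a (h : Carrier → ℕ) → ∑ (λ x → 𝟙 (x ≟ a) ℕ.* h x) ≡ h a
  ∑-delta-* a h = begin
    ∑ (λ x → 𝟙 (x ≟ a) ℕ.* h x) ≡⟨ sum-cong-≗ (λ i → pointwise (element i)) ⟩
    ∑ (λ x → 𝟙 (x ≟ a) ℕ.* h a) ≡⟨ sym (*-distribʳ-sum (h a) (λ i → 𝟙 (element i ≟ a))) ⟩
    ∑ (λ x → 𝟙 (x ≟ a)) ℕ.* h a ≡⟨ cong (ℕ._* h a) (∑-delta a) ⟩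
    1 ℕ.* h a                   ≡⟨ ℕₚ.*-identityˡ (h a) ⟩
    h a                         ∎
    where
    pointwise : ∀ x → 𝟙 (x ≟ a) ℕ.* h x ≡ 𝟙 (x ≟ a) ℕ.* h a
    pointwise x with x ≟ a
    ... | yes refl = refl
    ... | no _     = refl

  inv : ∀ x → x ≢ 0# → Carrier
  inv x x≢0 = proj₁ (inverse x x≢0)

  inv-r : ∀ x (x≢0 : x ≢ 0#) → x * inv x x≢0 ≡ 1#
  inv-r x x≢0 = proj₂ (inverse x x≢0)

  inv-l : ∀ x (x≢0 : x ≢ 0#) → inv x x≢0 * x ≡ 1#
  inv-l x x≢0 = trans (*-comm _ x) (inv-r x x≢0)

  *-cancel-inv : ∀ x (x≢0 : x ≢ 0#) y → inv x x≢0 * (x * y) ≡ y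
  *-cancel-inv x x≢0 y = trans (sym (*-assoc _ x y)) (trans (cong (_* y) (inv-l x x≢0)) (*-identityˡ y))

  zero-divisor : ∀ {x y} → x * y ≡ 0# → x ≢ 0# → y ≡ 0#
  zero-divisor {x} {y} xy≡0 x≢0 = begin
    y                   ≡⟨ sym (*-cancel-inv x x≢0 y) ⟩
    inv x x≢0 * (x * y) ≡⟨ cong (inv x x≢0 *_) xy≡0 ⟩
    inv x x≢0 * 0#      ≡⟨ zeroʳ _ ⟩
    0#                  ∎

  *-≢0 : ∀ {x y} → x ≢ 0# → y ≢ 0# → x * y ≢ 0#
  *-≢0 x≢0 y≢0 xy≡0 = y≢0 (zero-divisor xy≡0 x≢0)

  ^-≢0 : ∀ {x} k → x ≢ 0# → x ^ k ≢ 0#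
  ^-≢0 zero    x≢0 1≡0 = 0≢1 (sym 1≡0)
  ^-≢0 (suc k) x≢0     = *-≢0 x≢0 (^-≢0 k x≢0)

  module Reindex (_∙_ : Carrier → Carrier → Carrier) (ε : Carrier) (isCM : IsCommutativeMonoid _≡_ _∙_ ε) where

    monoid : CommutativeMonoid 0ℓ 0ℓ
    monoid = record { isCommutativeMonoid = isCM }

    open MonoidSum monoid public using () renaming (sum to fold; ∑-distrib-+ to fold-distrib; sum-cong-≗ to fold-cong)
    open MonoidSum monoid using (sum-permute)

    ⨁ : (Carrier → Carrier) → Carrier
    ⨁ φ = fold (φ ∘ element)

    ⨁-bijection : (σ σ⁻¹ : Carrier → Carrier) → (∀ x → σ (σ⁻¹ x) ≡ x) → (∀ x → σ⁻¹ (σ x) ≡ x) →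
      ∀ φ → ⨁ φ ≡ ⨁ (φ ∘ σ)
    ⨁-bijection σ σ⁻¹ σσ⁻¹ σ⁻¹σ φ =
      trans (sum-permute (φ ∘ element) π) (fold-cong (λ i → cong φ (element-index (σ (element i)))))
      where
      lift : (τ τ′ : Carrier → Carrier) → (∀ x → τ (τ′ x) ≡ x) → ∀ i → index (τ (element (index (τ′ (element i))))) ≡ i
      lift τ τ′ ττ′ i = trans (cong (index ∘ τ) (element-index _)) (trans (cong index (ττ′ (element i))) (index-element i))
      π : Permutation q q
      π = permutation (index ∘ σ ∘ element) (index ∘ σ⁻¹ ∘ element) (lift σ σ⁻¹ σσ⁻¹) (lift σ⁻¹ σ σ⁻¹σ)

  module Additive       = Reindex _+_ 0# +-isCommutativeMonoid
  module Multiplicative = Reindex _*_ 1# *-isCommutativeMonoid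

  +-interchange : ∀ a b c d → (a + b) + (c + d) ≡ (a + c) + (b + d)
  +-interchange = interchange (CommutativeMonoid.commutativeSemigroup Additive.monoid)

  _·1 : ℕ → Carrier
  zero  ·1 = 0#
  suc n ·1 = 1# + n ·1

  ·1-+ : ∀ a b → (a ℕ.+ b) ·1 ≡ a ·1 + b ·1
  ·1-+ zero    b = sym (+-identityˡ _)
  ·1-+ (suc a) b = trans (cong (1# +_) (·1-+ a b)) (sym (+-assoc _ _ _))

  +-cancel-right : ∀ {a b} → a + b ≡ a → b ≡ 0#
  +-cancel-right {a} {b} a+b≡a = begin
    b              ≡⟨ sym (+-identityˡ b) ⟩
    0# + b         ≡⟨ cong (_+ b) (sym neg+a) ⟩
    (- a + a) + b  ≡⟨ +-assoc _ _ _ ⟩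
    - a + (a + b)  ≡⟨ cong (- a +_) a+b≡a ⟩
    - a + a        ≡⟨ neg+a ⟩
    0#             ∎
    where
    neg+a : - a + a ≡ 0#
    neg+a = trans (+-comm _ _) (-‿inverseʳ a)

  -- q · 1 = 0: translating by 1 permutes the field, so adding 1 to every
  -- element does not change the sum of all elements.
  q·1≡0 : q ·1 ≡ 0#
  q·1≡0 = +-cancel-right (sym (begin
    ⨁ id                       ≡⟨ ⨁-bijection (_+ 1#) (_+ (- 1#)) (λ x → translate x (-‿inverseʳ 1#))
                                                                    (λ x → translate x (trans (+-comm _ _) (-‿inverseʳ 1#))) id ⟩
    ⨁ (_+ 1#)                  ≡⟨ fold-distrib element (λ _ → 1#) ⟩
    ⨁ id + fold {q} (λ _ → 1#) ≡⟨ cong (⨁ id +_) (ones q) ⟩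
    ⨁ id + q ·1                ∎))
    where
    open Additive
    translate : ∀ x {s t} → s + t ≡ 0# → (x + t) + s ≡ x
    translate x {s} {t} s+t≡0 = trans (+-assoc x t s) (trans (cong (x +_) (trans (+-comm t s) s+t≡0)) (+-identityʳ x))
    ones : ∀ n → fold {n} (λ _ → 1#) ≡ n ·1
    ones zero    = refl
    ones (suc n) = cong (1# +_) (ones n)

  ∏≢0 : ∀ {n} (t : Fin n → Carrier) → (∀ j → t j ≢ 0#) → Multiplicative.fold t ≢ 0#
  ∏≢0 {zero}  t t≢0 1≡0 = 0≢1 (sym 1≡0)
  ∏≢0 {suc n} t t≢0     = *-≢0 (t≢0 zero) (∏≢0 (t ∘ suc) (t≢0 ∘ suc))

  ∏-const : ∀ {n} (t : Fin n → Carrier) a → (∀ j → t j ≡ a) → Multiplicative.fold t ≡ a ^ n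
  ∏-const {zero}  t a t≡a = refl
  ∏-const {suc n} t a t≡a = cong₂ _*_ (t≡a zero) (∏-const (t ∘ suc) a (t≡a ∘ suc))

  ∏-all-but-one : ∀ {n} (t : Fin n → Carrier) a (j₀ : Fin n) → t j₀ ≡ 1# → (∀ j → j ≢ j₀ → t j ≡ a) →
    Multiplicative.fold t ≡ a ^ (n ℕ.∸ 1)
  ∏-all-but-one {suc n} t a zero t₀≡1 t≡a =
    trans (cong₂ _*_ t₀≡1 (∏-const (t ∘ suc) a (λ j → t≡a (suc j) (λ ())))) (*-identityˡ _)
  ∏-all-but-one {suc (suc n)} t a (suc j₀) t₀≡1 t≡a =
    cong₂ _*_ (t≡a zero (λ ())) (∏-all-but-one (t ∘ suc) a j₀ t₀≡1 (λ j j≢j₀ → t≡a (suc j) (j≢j₀ ∘ Finₚ.suc-injective)))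

  -- Let ⌊y⌋ be y for y ≠ 0 and 1 for y = 0, so that
  -- P = ∏ₓ ⌊x⌋ ≠ 0. Multiplication by a ≠ 0 permutes F and ⌊a y⌋ = factor a y · ⌊y⌋,
  -- where factor a y is a for y ≠ 0 and 1 for y = 0; hence P = a ^ (q - 1) · P.
  ⌊_⌋ : Carrier → Carrier
  ⌊ y ⌋ with y ≟ 0#
  ... | yes _ = 1#
  ... | no _  = y

  factor : Carrier → Carrier → Carrier
  factor a y with y ≟ 0#
  ... | yes _ = 1#
  ... | no _  = a

  ⌊0⌋ : ⌊ 0# ⌋ ≡ 1#
  ⌊0⌋ with 0# ≟ 0#
  ... | yes _ = refl
  ... | no 0≢0 = ⊥-elim (0≢0 refl)

  ⌊≢0⌋ : ∀ {y} → y ≢ 0# → ⌊ y ⌋ ≡ y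
  ⌊≢0⌋ {y} y≢0 with y ≟ 0#
  ... | yes y≡0 = ⊥-elim (y≢0 y≡0)
  ... | no _    = refl

  ⌊⌋≢0 : ∀ y → ⌊ y ⌋ ≢ 0#
  ⌊⌋≢0 y with y ≟ 0#
  ... | yes _   = λ 1≡0 → 0≢1 (sym 1≡0)
  ... | no y≢0  = y≢0

  factor-0 : ∀ a → factor a 0# ≡ 1#
  factor-0 a with 0# ≟ 0#
  ... | yes _ = refl
  ... | no 0≢0 = ⊥-elim (0≢0 refl)

  factor-≢0 : ∀ a {y} → y ≢ 0# → factor a y ≡ a
  factor-≢0 a {y} y≢0 with y ≟ 0#
  ... | yes y≡0 = ⊥-elim (y≢0 y≡0)
  ... | no _    = refl

  ⌊*⌋ : ∀ {a} → a ≢ 0# → ∀ y → ⌊ a * y ⌋ ≡ factor a y * ⌊ y ⌋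
  ⌊*⌋ {a} a≢0 y = byCases (y ≟ 0#)
    where
    byCases : Dec (y ≡ 0#) → ⌊ a * y ⌋ ≡ factor a y * ⌊ y ⌋
    byCases (yes y≡0) = begin
      ⌊ a * y ⌋             ≡⟨ cong ⌊_⌋ (trans (cong (a *_) y≡0) (zeroʳ a)) ⟩
      ⌊ 0# ⌋                ≡⟨ ⌊0⌋ ⟩
      1#                    ≡⟨ sym (*-identityˡ 1#) ⟩
      1# * 1#               ≡⟨ sym (cong₂ _*_ (factor-0 a) ⌊0⌋) ⟩
      factor a 0# * ⌊ 0# ⌋  ≡⟨ cong (λ z → factor a z * ⌊ z ⌋) (sym y≡0) ⟩
      factor a y * ⌊ y ⌋    ∎
    byCases (no y≢0) = trans (⌊≢0⌋ (*-≢0 a≢0 y≢0)) (sym (cong₂ _*_ (factor-≢0 a y≢0) (⌊≢0⌋ y≢0)))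

  fermat : ∀ {a} → a ≢ 0# → a ^ (q ℕ.∸ 1) ≡ 1#
  fermat {a} a≢0 = begin
    A           ≡⟨ sym (*-identityʳ A) ⟩
    A * 1#      ≡⟨ cong (A *_) (sym (inv-r P P≢0)) ⟩
    A * (P * P′) ≡⟨ sym (*-assoc A P P′) ⟩
    (A * P) * P′ ≡⟨ cong (_* P′) (sym P≡A*P) ⟩
    P * P′       ≡⟨ inv-r P P≢0 ⟩
    1#           ∎
    where
    open Multiplicative
    A : Carrier
    A = a ^ (q ℕ.∸ 1)
    P : Carrier
    P = ⨁ ⌊_⌋
    P≢0 : P ≢ 0#
    P≢0 = ∏≢0 (⌊_⌋ ∘ element) (⌊⌋≢0 ∘ element)
    P′ : Carrier
    P′ = inv P P≢0

    ∏⌊a⌋≡A : ⨁ (factor a) ≡ A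
    ∏⌊a⌋≡A = ∏-all-but-one (factor a ∘ element) a (index 0#) (trans (cong (factor a) (element-index 0#)) (factor-0 a))
      (λ j j≢0 → factor-≢0 a (λ eq → j≢0 (trans (sym (index-element j)) (cong index eq))))

    P≡A*P : P ≡ A * P
    P≡A*P = begin
      P                             ≡⟨ ⨁-bijection (a *_) (inv a a≢0 *_) (λ y → trans (sym (*-assoc a _ y)) (trans (cong (_* y) (inv-r a a≢0)) (*-identityˡ y)))
                                         (*-cancel-inv a a≢0) ⌊_⌋ ⟩
      ⨁ (λ y → ⌊ a * y ⌋)           ≡⟨ fold-cong (⌊*⌋ a≢0 ∘ element) ⟩
      ⨁ (λ y → factor a y * ⌊ y ⌋)  ≡⟨ fold-distrib (factor a ∘ element) (⌊_⌋ ∘ element) ⟩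
      ⨁ (factor a) * P              ≡⟨ cong (_* P) ∏⌊a⌋≡A ⟩
      A * P                         ∎

  *-^[q-2] : 2 ℕ.≤ q → ∀ {x} → x ≢ 0# → x * x ^ (q ℕ.∸ 2) ≡ 1#
  *-^[q-2] 2≤q {x} x≢0 = trans (cong (x ^_) (sym (ℕₚ.+-∸-assoc 1 2≤q))) (fermat x≢0)

module Char2 {m : ℕ} (F : FiniteField (2 ℕ.^ m)) where

  import Data.Nat.Properties as ℕₚ
  open import Relation.Nullary using (yes; no)
  open import Relation.Binary.PropositionalEquality
  open import Data.Empty using (⊥-elim)
  open FieldFacts F
  open ≡-Reasoning

  2^·1 : ∀ k → (2 ℕ.^ k) ·1 ≡ (1# + 1#) ^ k
  2^·1 zero    = +-identityʳ 1#
  2^·1 (suc k) = begin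
    (2 ℕ.^ k ℕ.+ (2 ℕ.^ k ℕ.+ 0)) ·1 ≡⟨ cong (λ n → (2 ℕ.^ k ℕ.+ n) ·1) (ℕₚ.+-identityʳ _) ⟩
    (2 ℕ.^ k ℕ.+ 2 ℕ.^ k) ·1         ≡⟨ ·1-+ (2 ℕ.^ k) (2 ℕ.^ k) ⟩
    (2 ℕ.^ k) ·1 + (2 ℕ.^ k) ·1      ≡⟨ cong₂ _+_ (2^·1 k) (2^·1 k) ⟩
    y + y                            ≡⟨ sym (cong₂ _+_ (*-identityˡ y) (*-identityˡ y)) ⟩
    1# * y + 1# * y                  ≡⟨ sym (distribʳ y 1# 1#) ⟩
    (1# + 1#) * y                    ∎
    where
    y : Carrier
    y = (1# + 1#) ^ k

  -- Since (1 + 1) ^ m = 2 ^ m · 1 = 0 and F has no zero divisors, 1 + 1 = 0.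
  1+1≡0 : 1# + 1# ≡ 0#
  1+1≡0 with 1# + 1# ≟ 0#
  ... | yes 2≡0 = 2≡0
  ... | no 2≢0  = ⊥-elim (^-≢0 m 2≢0 (trans (sym (2^·1 m)) q·1≡0))

  x+x≡0 : ∀ x → x + x ≡ 0#
  x+x≡0 x = begin
    x + x           ≡⟨ sym (cong₂ _+_ (*-identityʳ x) (*-identityʳ x)) ⟩
    x * 1# + x * 1# ≡⟨ sym (distribˡ x 1# 1#) ⟩
    x * (1# + 1#)   ≡⟨ cong (x *_) 1+1≡0 ⟩
    x * 0#          ≡⟨ zeroʳ x ⟩
    0#              ∎

  x+y+y≡x : ∀ x y → (x + y) + y ≡ x
  x+y+y≡x x y = begin
    (x + y) + y ≡⟨ +-assoc x y y ⟩
    x + (y + y) ≡⟨ cong (x +_) (x+x≡0 y) ⟩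
    x + 0#      ≡⟨ +-identityʳ x ⟩
    x           ∎

  +-move : ∀ {x y z} → x + y ≡ z → x ≡ z + y
  +-move {x} {y} x+y≡z = trans (sym (x+y+y≡x x y)) (cong (_+ y) x+y≡z)

  +-move⁻ : ∀ {x y z} → x ≡ z + y → x + y ≡ z
  +-move⁻ x≡z+y = sym (+-move (sym x≡z+y))

  +-cancelʳ : ∀ {x y c} → x + c ≡ y + c → x ≡ y
  +-cancelʳ {x} {y} {c} eq = trans (sym (x+y+y≡x x c)) (trans (cong (_+ c) eq) (x+y+y≡x y c))

  +≡0⇒≡ : ∀ {x y} → x + y ≡ 0# → x ≡ y
  +≡0⇒≡ x+y≡0 = trans (+-move x+y≡0) (+-identityˡ _)

  +-exchange : ∀ {A B C D} → A + B ≡ C + D → A + C ≡ B + D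
  +-exchange {A} {B} {C} {D} eq = +-move⁻ (begin
    A        ≡⟨ +-move eq ⟩
    (C + D) + B ≡⟨ +-assoc C D B ⟩
    C + (D + B) ≡⟨ cong (C +_) (+-comm D B) ⟩
    C + (B + D) ≡⟨ +-comm C _ ⟩
    (B + D) + C ∎)

module OPoly {m : ℕ} (m≥1 : m ℕ.≥ 1) (F : FiniteField (2 ℕ.^ m))
  (f : FiniteField.Poly F) (isOPoly : FiniteField.IsOPolynomial F f) where

  import Data.Nat.Properties as ℕₚ
  open import Data.Product using (proj₁; proj₂)
  open import Data.Sum using (_⊎_; inj₁; inj₂)
  open import Relation.Nullary using (yes; no)
  open import Relation.Binary.PropositionalEquality
  open import Function using (_∘_)
  open import Function.Definitions using (Bijective)
  open Counting
  open FieldFacts F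
  open Char2 {m} F
  open ≡-Reasoning

  q : ℕ
  q = 2 ℕ.^ m

  2≤q : 2 ℕ.≤ q
  2≤q = ℕₚ.^-monoʳ-≤ 2 m≥1

  f̂ : Carrier → Carrier
  f̂ = eval f

  f̂-bijective : Bijective _≡_ _≡_ f̂
  f̂-bijective = proj₁ (proj₂ isOPoly)

  -- The slope z ↦ (f (z + a) + f a) z ^ (q - 2) of the chord of f from a to z + a;
  -- the o-polynomial condition says it is a bijection for each a.
  slope : Carrier → Carrier → Carrier
  slope a z = (f̂ (z + a) + f̂ a) * z ^ (q ℕ.∸ 2)

  slope-bijective : ∀ a → Bijective _≡_ _≡_ (slope a)
  slope-bijective = proj₂ (proj₂ isOPoly)

  slope-0 : ∀ a → slope a 0# ≡ 0#
  slope-0 a = begin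
    (f̂ (0# + a) + f̂ a) * Z ≡⟨ cong (λ t → (f̂ t + f̂ a) * Z) (+-identityˡ a) ⟩
    (f̂ a + f̂ a) * Z        ≡⟨ cong (_* Z) (x+x≡0 (f̂ a)) ⟩
    0# * Z                 ≡⟨ zeroˡ Z ⟩
    0#                     ∎
    where
    Z : Carrier
    Z = 0# ^ (q ℕ.∸ 2)

  slope-≡ : ∀ a b {z} → z ≢ 0# → f̂ (z + a) + f̂ a ≡ b * z → slope a z ≡ b
  slope-≡ a b {z} z≢0 chord = begin
    (f̂ (z + a) + f̂ a) * Z ≡⟨ cong (_* Z) chord ⟩
    (b * z) * Z            ≡⟨ *-assoc b z Z ⟩
    b * (z * Z)            ≡⟨ cong (b *_) (*-^[q-2] 2≤q z≢0) ⟩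
    b * 1#                 ≡⟨ *-identityʳ b ⟩
    b                      ∎
    where
    Z : Carrier
    Z = z ^ (q ℕ.∸ 2)

  slope-≡⁻ : ∀ a b {z} → z ≢ 0# → slope a z ≡ b → f̂ (z + a) + f̂ a ≡ b * z
  slope-≡⁻ a b {z} z≢0 slope≡b = begin
    C            ≡⟨ sym (*-identityʳ C) ⟩
    C * 1#       ≡⟨ cong (C *_) (sym (trans (*-comm Z z) (*-^[q-2] 2≤q z≢0))) ⟩
    C * (Z * z)  ≡⟨ sym (*-assoc C Z z) ⟩
    (C * Z) * z  ≡⟨ cong (_* z) slope≡b ⟩
    b * z        ∎
    where
    C : Carrier
    C = f̂ (z + a) + f̂ a
    Z : Carrier
    Z = z ^ (q ℕ.∸ 2)

  g : Carrier → Carrier → Carrier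
  g b x = f̂ x + b * x

  -- For b ≠ 0, every value g b a is taken exactly at a and at a partner a′ ≠ a,
  -- where a′ - a is the unique nonzero z for which the chord from a to a + z has slope b.
  module TwoToOne {b : Carrier} (b≢0 : b ≢ 0#) (a : Carrier) where

    z : Carrier
    z = proj₁ (proj₂ (slope-bijective a) b)

    slope-z : slope a z ≡ b
    slope-z = proj₂ (proj₂ (slope-bijective a) b) refl

    z≢0 : z ≢ 0#
    z≢0 z≡0 = b≢0 (trans (sym slope-z) (trans (cong (slope a) z≡0) (slope-0 a)))

    partner : Carrier
    partner = z + a

    a≢partner : a ≢ partner
    a≢partner a≡a′ = z≢0 (trans (+-move (sym a≡a′)) (x+x≡0 a))

    -- The chord from a to the partner has slope b, so g b takes the same value there.
    g-partner : g b partner ≡ g b a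
    g-partner = begin
      f̂ (z + a) + b * (z + a)            ≡⟨ cong₂ _+_ (+-move (slope-≡⁻ a b z≢0 slope-z)) (distribˡ b z a) ⟩
      (b * z + f̂ a) + (b * z + b * a)    ≡⟨ +-interchange (b * z) (f̂ a) (b * z) (b * a) ⟩
      (b * z + b * z) + (f̂ a + b * a)    ≡⟨ cong (_+ (f̂ a + b * a)) (x+x≡0 (b * z)) ⟩
      0# + (f̂ a + b * a)                 ≡⟨ +-identityˡ _ ⟩
      f̂ a + b * a                        ∎

    -- Any x ≠ a with g b x = g b a spans a chord of slope b from a, hence is the partner.
    g-fibre : ∀ x → g b x ≡ g b a → x ≡ a ⊎ x ≡ partner
    g-fibre x gx≡ga with x ≟ a
    ... | yes x≡a = inj₁ x≡a
    ... | no x≢a  = inj₂ (trans (sym (x+y+y≡x x a)) (cong (_+ a) x+a≡z))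
      where
      x+a≢0 : x + a ≢ 0#
      x+a≢0 = x≢a ∘ +≡0⇒≡
      chord : f̂ ((x + a) + a) + f̂ a ≡ b * (x + a)
      chord = trans (cong (λ t → f̂ t + f̂ a) (x+y+y≡x x a)) (trans (+-exchange gx≡ga) (sym (distribˡ b x a)))
      x+a≡z : x + a ≡ z
      x+a≡z = proj₁ (slope-bijective a) (trans (slope-≡ a b x+a≢0 chord) (sym slope-z))

    fibre-size : ∀ c → ∑ (λ x → 𝟙 (g b x + c ≟ g b a + c)) ≡ 2
    fibre-size c = begin
      ∑ (λ x → 𝟙 (g b x + c ≟ g b a + c))          ≡⟨ sum-cong-≗ (λ i → split (element i)) ⟩
      ∑ (λ x → 𝟙 (x ≟ a) ℕ.+ 𝟙 (x ≟ partner))      ≡⟨ ∑-distrib-+ (λ i → 𝟙 (element i ≟ a)) (λ i → 𝟙 (element i ≟ partner)) ⟩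
      ∑ (λ x → 𝟙 (x ≟ a)) ℕ.+ ∑ (λ x → 𝟙 (x ≟ partner)) ≡⟨ cong₂ ℕ._+_ (∑-delta a) (∑-delta partner) ⟩
      2                                             ∎
      where
      split : ∀ x → 𝟙 (g b x + c ≟ g b a + c) ≡ 𝟙 (x ≟ a) ℕ.+ 𝟙 (x ≟ partner)
      split x = 𝟙-⊎ (g b x + c ≟ g b a + c) (x ≟ a) (x ≟ partner)
        (g-fibre x ∘ +-cancelʳ) (λ x≡a → cong (λ t → g b t + c) x≡a)
        (λ x≡a′ → trans (cong (λ t → g b t + c) x≡a′) (cong (_+ c) g-partner))
        (λ x≡a x≡a′ → a≢partner (trans (sym x≡a) x≡a′))

module Blocks {m : ℕ} (m≥1 : m ℕ.≥ 1) (F : FiniteField (2 ℕ.^ m))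
  (f : FiniteField.Poly F) (isOPoly : FiniteField.IsOPolynomial F f) where

  import Data.Nat.Properties as ℕₚ
  open import Data.Nat.DivMod using (m/n<m; m*n/n≡m)
  open import Data.Fin.Subset using (Subset; ⁅_⁆; ⋃; ∣_∣; _∈_)
  open import Data.Fin.Subset.Properties using (_∈?_)
  open import Data.List using (map)
  import Data.List.Properties as Listₚ
  open import Data.Product using (∃; _,_; proj₁; proj₂)
  open import Relation.Nullary using (yes; no; ¬?)
  open import Relation.Binary.PropositionalEquality
  open import Function using (id)
  open Counting
  open Subsets
  open FieldFacts F
  open Char2 {m} F
  open OPoly m≥1 F f isOPoly
  open ≡-Reasoning

  k : ℕ
  k = q ℕ./ 2

  k<q : k ℕ.< q
  k<q = m/n<m q 2 {{ℕ.>-nonZero (ℕₚ.≤-trans (ℕ.s≤s ℕ.z≤n) 2≤q)}} (ℕ.s≤s (ℕ.s≤s ℕ.z≤n))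

  ∈-block⁻ : ∀ {b c i} → i ∈ block f b c → ∃ λ x → g b x + c ≡ element i
  ∈-block⁻ {b} {c} {i} i∈B with ∈-image⁻ (λ x → index (g b x + c)) elems i∈B
  ... | x , index≡i = x , trans (sym (element-index _)) (cong element index≡i)

  ∈-block⁺ : ∀ {b c i} x → g b x + c ≡ element i → i ∈ block f b c
  ∈-block⁺ {b} {c} {i} x gx≡i =
    subst (λ xs → i ∈ ⋃ (map (λ x → ⁅ index (g b x + c) ⁆) xs)) (sym (Listₚ.map-tabulate id element))
      (∈-image⁺ (λ x → index (g b x + c)) element (index x)
        (trans (cong (λ t → index (g b t + c)) (element-index x)) (trans (cong index gx≡i) (index-element i))))

  hits : Carrier → Carrier → Carrier → ℕ
  hits b c y = ∑ (λ x → 𝟙 (g b x + c ≟ y))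

  hits-block : ∀ {b} c i → b ≢ 0# → hits b c (element i) ≡ 2 ℕ.* 𝟙 (i ∈? block f b c)
  hits-block {b} c i b≢0 with i ∈? block f b c
  ... | yes i∈B = let (a , ga≡i) = ∈-block⁻ i∈B in
    trans (cong (hits b c) (sym ga≡i)) (TwoToOne.fibre-size b≢0 a c)
  ... | no i∉B = trans (sum-cong-≗ (λ l → 𝟙-no (g b (element l) + c ≟ element i) (λ eq → i∉B (∈-block⁺ (element l) eq))))
                       (trans (sum-const q 0) (ℕₚ.*-zeroʳ q))

  -- Summing the hit counts over all points counts every x once.
  ∑-hits : ∀ b c → sum (λ i → hits b c (element i)) ≡ q
  ∑-hits b c = begin
    sum (λ i → sum (λ l → 𝟙 (g b (element l) + c ≟ element i))) ≡⟨ ∑-comm (λ i l → 𝟙 (g b (element l) + c ≟ element i)) ⟩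
    sum (λ l → sum (λ i → 𝟙 (g b (element l) + c ≟ element i))) ≡⟨ sum-cong-≗ (λ l → hit-once (g b (element l) + c)) ⟩
    sum {q} (λ _ → 1)                                            ≡⟨ sum-const q 1 ⟩
    q ℕ.* 1                                                      ≡⟨ ℕₚ.*-identityʳ q ⟩
    q                                                            ∎
    where
    hit-once : ∀ y → sum (λ i → 𝟙 (y ≟ element i)) ≡ 1
    hit-once y = trans (sum-cong-≗ (λ i → 𝟙-cong (y ≟ element i) (element i ≟ y) sym sym)) (∑-delta y)

  -- For b ≠ 0: 2 |B(b, c)| = Σᵢ hits = q, so |B(b, c)| = q / 2.
  ∣block∣≡k : ∀ {b} c → b ≢ 0# → ∣ block f b c ∣ ≡ k
  ∣block∣≡k {b} c b≢0 = begin
    ∣ B ∣               ≡⟨ sym (m*n/n≡m ∣ B ∣ 2) ⟩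
    (∣ B ∣ ℕ.* 2) ℕ./ 2 ≡⟨ cong (ℕ._/ 2) (trans (ℕₚ.*-comm ∣ B ∣ 2) twice) ⟩
    q ℕ./ 2             ∎
    where
    B : Subset q
    B = block f b c
    twice : 2 ℕ.* ∣ B ∣ ≡ q
    twice = begin
      2 ℕ.* ∣ B ∣                           ≡⟨ cong (2 ℕ.*_) (∣∣-sum B) ⟩
      2 ℕ.* sum (λ i → 𝟙 (i ∈? B))          ≡⟨ *-distribˡ-sum 2 (λ i → 𝟙 (i ∈? B)) ⟩
      sum (λ i → 2 ℕ.* 𝟙 (i ∈? B))          ≡⟨ sum-cong-≗ (λ i → sym (hits-block c i b≢0)) ⟩
      sum (λ i → hits b c (element i))      ≡⟨ ∑-hits b c ⟩
      q                                     ∎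

  -- B(0, c) is the whole field, because f is a permutation.
  ∣block0∣≡q : ∀ c → ∣ block f 0# c ∣ ≡ q
  ∣block0∣≡q c = trans (∣∣-sum (block f 0# c))
    (trans (sum-cong-≗ (λ i → 𝟙-yes (i ∈? block f 0# c) (∈-block0 i)))
           (trans (sum-const q 1) (ℕₚ.*-identityʳ q)))
    where
    ∈-block0 : ∀ i → i ∈ block f 0# c
    ∈-block0 i = ∈-block⁺ x (begin
      (f̂ x + 0# * x) + c  ≡⟨ cong (λ t → (f̂ x + t) + c) (zeroˡ x) ⟩
      (f̂ x + 0#) + c      ≡⟨ cong (_+ c) (+-identityʳ (f̂ x)) ⟩
      f̂ x + c             ≡⟨ cong (_+ c) f̂x≡ ⟩
      (element i + c) + c ≡⟨ x+y+y≡x (element i) c ⟩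
      element i           ∎)
      where
      x : Carrier
      x = proj₁ (proj₂ f̂-bijective (element i + c))
      f̂x≡ : f̂ x ≡ element i + c
      f̂x≡ = proj₂ (proj₂ f̂-bijective (element i + c)) refl

  nonzero : Carrier → ℕ
  nonzero b = 𝟙 (¬? (b ≟ 0#))

  𝟙-∣block∣≡k : ∀ b c → 𝟙 (∣ block f b c ∣ ℕ.≟ k) ≡ nonzero b
  𝟙-∣block∣≡k b c = 𝟙-cong (∣ block f b c ∣ ℕ.≟ k) (¬? (b ≟ 0#)) size⇒b≢0 (∣block∣≡k c)
    where
    size⇒b≢0 : ∣ block f b c ∣ ≡ k → b ≢ 0#
    size⇒b≢0 size≡k refl = ℕₚ.<-irrefl (trans (sym size≡k) (∣block0∣≡q c)) k<q

-- Double counting the blocks through two distinct points u and v, weighted by 4: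
--   4 Λ = Σ_{b ≠ 0} Σ_c hits(u) hits(v)                       (hits = 2 · membership)
--       = Σ_{b ≠ 0} #{(x, y) : g b x + g b y = u + v}           (summing over c)
--       = #{(x, y) : x ≠ y, f x + f y ≠ u + v}                  (one slope b per x ≠ y)
--       = q (q - 2).
module PairCount {m : ℕ} (m≥1 : m ℕ.≥ 1) (F : FiniteField (2 ℕ.^ m))
  (f : FiniteField.Poly F) (isOPoly : FiniteField.IsOPolynomial F f)
  (i j : Fin (2 ℕ.^ m)) (i≢j : i ≢ j) where

  import Data.Nat.Properties as ℕₚ
  open import Data.Nat.DivMod using (m*n/n≡m)
  open import Data.Nat.Solver using (module +-*-Solver)
  open import Data.Fin.Subset.Properties using (_∈?_)
  open import Data.Product using (_×_; _,_; proj₁; proj₂)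
  open import Relation.Nullary using (Dec; yes; no; ¬?)
  open import Relation.Nullary.Decidable using (_×-dec_)
  open import Relation.Binary.PropositionalEquality
  open import Function using (_∘_)
  open Counting
  open FieldFacts F
  open Char2 {m} F
  open OPoly m≥1 F f isOPoly
  open Blocks m≥1 F f isOPoly
  open ≡-Reasoning

  u v d : Carrier
  u = element i
  v = element j
  d = u + v

  d≢0 : d ≢ 0#
  d≢0 d≡0 = i≢j (trans (sym (index-element i)) (trans (cong index (+≡0⇒≡ d≡0)) (index-element j)))

  Λ : ℕ
  Λ = ∑ (λ b → ∑ (λ c → nonzero b ℕ.* (𝟙 (i ∈? block f b c) ℕ.* 𝟙 (j ∈? block f b c))))

  chord : Carrier → Carrier → Carrier → ℕ
  chord b x y = 𝟙 (g b x + g b y ≟ d)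

  -- Indicator of x ≠ y and f x + f y ≠ d: exactly the pairs for which some
  -- b ≠ 0 satisfies g b x + g b y = d.
  admissible : Carrier → Carrier → ℕ
  admissible x y = 𝟙 (¬? (x ≟ y) ×-dec ¬? (f̂ x + f̂ y ≟ d))

  -- Membership of both points, counted with the multiplicity two from each point.
  four-memberships : ∀ b c → 4 ℕ.* (nonzero b ℕ.* (𝟙 (i ∈? block f b c) ℕ.* 𝟙 (j ∈? block f b c))) ≡
    nonzero b ℕ.* (hits b c u ℕ.* hits b c v)
  four-memberships b c with b ≟ 0#
  ... | yes _   = refl
  ... | no b≢0  = begin
    4 ℕ.* ((mi ℕ.* mj) ℕ.+ 0)      ≡⟨ cong (4 ℕ.*_) (ℕₚ.+-identityʳ (mi ℕ.* mj)) ⟩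
    4 ℕ.* (mi ℕ.* mj)              ≡⟨ doubling mi mj ⟩
    (2 ℕ.* mi) ℕ.* (2 ℕ.* mj)      ≡⟨ sym (cong₂ ℕ._*_ (hits-block c i b≢0) (hits-block c j b≢0)) ⟩
    hits b c u ℕ.* hits b c v      ≡⟨ sym (ℕₚ.+-identityʳ (hits b c u ℕ.* hits b c v)) ⟩
    (hits b c u ℕ.* hits b c v) ℕ.+ 0 ∎
    where
    mi : ℕ
    mi = 𝟙 (i ∈? block f b c)
    mj : ℕ
    mj = 𝟙 (j ∈? block f b c)
    doubling : ∀ x y → 4 ℕ.* (x ℕ.* y) ≡ (2 ℕ.* x) ℕ.* (2 ℕ.* y)
    doubling = +-*-Solver.solve 2 (λ x y → con 4 :* (x :* y) := (con 2 :* x) :* (con 2 :* y)) refl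
      where open +-*-Solver

  -- Fixing x and y, exactly one translate c sends x to u, and it sends y to v
  -- iff g b x + g b y = d.
  ∑-translates : ∀ b x y → ∑ (λ c → 𝟙 (g b x + c ≟ u) ℕ.* 𝟙 (g b y + c ≟ v)) ≡ chord b x y
  ∑-translates b x y = begin
    ∑ (λ c → 𝟙 (g b x + c ≟ u) ℕ.* 𝟙 (g b y + c ≟ v))
      ≡⟨ sum-cong-≗ (λ l → cong (ℕ._* _) (𝟙-cong (g b x + element l ≟ u) (element l ≟ u + g b x)
           (λ eq → +-move (trans (+-comm _ (g b x)) eq)) (λ eq → trans (+-comm (g b x) _) (+-move⁻ eq)))) ⟩
    ∑ (λ c → 𝟙 (c ≟ u + g b x) ℕ.* 𝟙 (g b y + c ≟ v)) ≡⟨ ∑-delta-* (u + g b x) (λ c → 𝟙 (g b y + c ≟ v)) ⟩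
    𝟙 (g b y + (u + g b x) ≟ v)                        ≡⟨ 𝟙-cong _ _ forward backward ⟩
    chord b x y                                        ∎
    where
    rearrange : g b y + (u + g b x) ≡ (g b x + g b y) + u
    rearrange = trans (cong (g b y +_) (+-comm u (g b x))) (trans (sym (+-assoc _ _ u)) (cong (_+ u) (+-comm _ _)))
    forward : g b y + (u + g b x) ≡ v → g b x + g b y ≡ d
    forward eq = trans (+-move (trans (sym rearrange) eq)) (+-comm v u)
    backward : g b x + g b y ≡ d → g b y + (u + g b x) ≡ v
    backward eq = trans rearrange (+-move⁻ (trans eq (+-comm u v)))

  ∑-hits-product : ∀ b → ∑ (λ c → hits b c u ℕ.* hits b c v) ≡ ∑ (λ x → ∑ (λ y → chord b x y))
  ∑-hits-product b = begin
    ∑ (λ c → hits b c u ℕ.* hits b c v)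
      ≡⟨ sum-cong-≗ (λ l → product-of-sums (λ p → 𝟙 (g b (element p) + element l ≟ u)) (λ p → 𝟙 (g b (element p) + element l ≟ v))) ⟩
    ∑ (λ c → ∑ (λ x → ∑ (λ y → 𝟙 (g b x + c ≟ u) ℕ.* 𝟙 (g b y + c ≟ v))))
      ≡⟨ ∑-comm (λ l p → ∑ (λ y → 𝟙 (g b (element p) + element l ≟ u) ℕ.* 𝟙 (g b y + element l ≟ v))) ⟩
    ∑ (λ x → ∑ (λ c → ∑ (λ y → 𝟙 (g b x + c ≟ u) ℕ.* 𝟙 (g b y + c ≟ v))))
      ≡⟨ sum-cong-≗ (λ p → ∑-comm (λ l p′ → 𝟙 (g b (element p) + element l ≟ u) ℕ.* 𝟙 (g b (element p′) + element l ≟ v))) ⟩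
    ∑ (λ x → ∑ (λ y → ∑ (λ c → 𝟙 (g b x + c ≟ u) ℕ.* 𝟙 (g b y + c ≟ v))))
      ≡⟨ sum-cong-≗ (λ p → sum-cong-≗ (λ p′ → ∑-translates b (element p) (element p′))) ⟩
    ∑ (λ x → ∑ (λ y → chord b x y)) ∎
    where
    product-of-sums : ∀ {n} (s t : Fin n → ℕ) → sum s ℕ.* sum t ≡ sum (λ x → sum (λ y → s x ℕ.* t y))
    product-of-sums s t = trans (*-distribʳ-sum (sum t) s) (sum-cong-≗ (λ x → *-distribˡ-sum (s x) t))

  -- For x ≠ y the chord condition g b x + g b y = d is linear in b with the
  -- unique solution b = (d + f x + f y) / (x + y), which is nonzero iff f x + f y ≠ d.
  ∑-slopes : ∀ x y → ∑ (λ b → nonzero b ℕ.* chord b x y) ≡ admissible x y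
  ∑-slopes x y = byCases (x ≟ y)
    where
    byCases : Dec (x ≡ y) → ∑ (λ b → nonzero b ℕ.* chord b x y) ≡ admissible x y
    byCases (yes x≡y) = trans (sum-cong-≗ (λ l → no-term (element l))) (trans (trans (sum-const q 0) (ℕₚ.*-zeroʳ q))
      (sym (𝟙-no (¬? (x ≟ y) ×-dec ¬? (f̂ x + f̂ y ≟ d)) (λ (x≢y , _) → x≢y x≡y))))
      where
      no-chord : ∀ b → g b x + g b y ≢ d
      no-chord b eq = d≢0 (trans (sym eq) (trans (cong (λ t → g b x + g b t) (sym x≡y)) (x+x≡0 (g b x))))
      no-term : ∀ b → nonzero b ℕ.* chord b x y ≡ 0
      no-term b = trans (cong (nonzero b ℕ.*_) (𝟙-no (g b x + g b y ≟ d) (no-chord b))) (ℕₚ.*-zeroʳ (nonzero b))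
    byCases (no x≢y) = begin
      ∑ (λ b → nonzero b ℕ.* chord b x y) ≡⟨ sum-cong-≗ (λ l → trans (ℕₚ.*-comm (nonzero (element l)) _) (cong (ℕ._* _) (on-slope (element l)))) ⟩
      ∑ (λ b → 𝟙 (b ≟ slope₀) ℕ.* nonzero b) ≡⟨ ∑-delta-* slope₀ nonzero ⟩
      nonzero slope₀                         ≡⟨ 𝟙-cong _ (¬? (x ≟ y) ×-dec ¬? (f̂ x + f̂ y ≟ d)) (λ slope₀≢0 → x≢y , slope₀≢0 ∘ slope₀≡0) (λ (_ , s≢d) slope₀≡0 → s≢d (slope₀≡0⁻ slope₀≡0)) ⟩
      admissible x y                         ∎
      where
      z : Carrier
      z = x + y
      z≢0 : z ≢ 0#
      z≢0 = x≢y ∘ +≡0⇒≡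
      z⁻¹ : Carrier
      z⁻¹ = inv z z≢0
      s : Carrier
      s = f̂ x + f̂ y
      slope₀ : Carrier
      slope₀ = (d + s) * z⁻¹
      g-sum : ∀ b → g b x + g b y ≡ s + b * z
      g-sum b = trans (+-interchange (f̂ x) (b * x) (f̂ y) (b * y)) (cong (s +_) (sym (distribˡ b x y)))
      divide : ∀ {w b} → w ≡ b * z → b ≡ w * z⁻¹
      divide {w} {b} w≡bz = begin
        b               ≡⟨ sym (*-identityʳ b) ⟩
        b * 1#          ≡⟨ cong (b *_) (sym (inv-r z z≢0)) ⟩
        b * (z * z⁻¹)   ≡⟨ sym (*-assoc b z z⁻¹) ⟩
        (b * z) * z⁻¹   ≡⟨ cong (_* z⁻¹) (sym w≡bz) ⟩
        w * z⁻¹         ∎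
      on-slope : ∀ b → chord b x y ≡ 𝟙 (b ≟ slope₀)
      on-slope b = 𝟙-cong (g b x + g b y ≟ d) (b ≟ slope₀)
        (λ eq → divide (sym (+-move (trans (+-comm (b * z) s) (trans (sym (g-sum b)) eq)))))
        (λ b≡slope₀ → trans (g-sum b) (trans (+-comm s _) (+-move⁻ (sym (bz b≡slope₀)))))
        where
        bz : b ≡ slope₀ → d + s ≡ b * z
        bz b≡slope₀ = sym (begin
          b * z                ≡⟨ cong (_* z) b≡slope₀ ⟩
          ((d + s) * z⁻¹) * z  ≡⟨ *-assoc (d + s) z⁻¹ z ⟩
          (d + s) * (z⁻¹ * z)  ≡⟨ cong ((d + s) *_) (inv-l z z≢0) ⟩
          (d + s) * 1#         ≡⟨ *-identityʳ _ ⟩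
          d + s                ∎)
      slope₀≡0 : s ≡ d → slope₀ ≡ 0#
      slope₀≡0 s≡d = trans (cong (λ t → (d + t) * z⁻¹) s≡d) (trans (cong (_* z⁻¹) (x+x≡0 d)) (zeroˡ z⁻¹))
      slope₀≡0⁻ : slope₀ ≡ 0# → s ≡ d
      slope₀≡0⁻ slope₀≡0 = sym (+≡0⇒≡ (begin
        d + s               ≡⟨ sym (*-identityʳ _) ⟩
        (d + s) * 1#        ≡⟨ cong ((d + s) *_) (sym (inv-l z z≢0)) ⟩
        (d + s) * (z⁻¹ * z) ≡⟨ sym (*-assoc _ z⁻¹ z) ⟩
        slope₀ * z          ≡⟨ cong (_* z) slope₀≡0 ⟩
        0# * z              ≡⟨ zeroˡ z ⟩
        0#                  ∎))

  -- For fixed x, exactly two y are excluded: y = x and the y with f y = f x + d.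
  ∑-admissible : ∀ x → ∑ (admissible x) ≡ q ℕ.∸ 2
  ∑-admissible x = trans (sym (ℕₚ.m+n∸n≡m (∑ (admissible x)) 2)) (cong (ℕ._∸ 2) total)
    where
    y₀ : Carrier
    y₀ = proj₁ (proj₂ f̂-bijective (d + f̂ x))
    f̂y₀ : f̂ y₀ ≡ d + f̂ x
    f̂y₀ = proj₂ (proj₂ f̂-bijective (d + f̂ x)) refl

    to-y₀ : ∀ {y} → f̂ x + f̂ y ≡ d → y ≡ y₀
    to-y₀ {y} eq = proj₁ f̂-bijective (trans (+-move (trans (+-comm (f̂ y) (f̂ x)) eq)) (sym f̂y₀))

    from-y₀ : ∀ {y} → y ≡ y₀ → f̂ x + f̂ y ≡ d
    from-y₀ y≡y₀ = trans (+-comm (f̂ x) _) (+-move⁻ (trans (cong f̂ y≡y₀) f̂y₀))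

    partition : ∀ y → (admissible x y ℕ.+ 𝟙 (y ≟ x)) ℕ.+ 𝟙 (y ≟ y₀) ≡ 1
    partition y = byCases (y ≟ x) (f̂ x + f̂ y ≟ d)
      where
      adm : Dec ((x ≢ y) × (f̂ x + f̂ y ≢ d))
      adm = ¬? (x ≟ y) ×-dec ¬? (f̂ x + f̂ y ≟ d)
      byCases : Dec (y ≡ x) → Dec (f̂ x + f̂ y ≡ d) → (admissible x y ℕ.+ 𝟙 (y ≟ x)) ℕ.+ 𝟙 (y ≟ y₀) ≡ 1
      byCases (yes y≡x) _ = cong₂ ℕ._+_ (cong₂ ℕ._+_ (𝟙-no adm (λ (x≢y , _) → x≢y (sym y≡x))) (𝟙-yes (y ≟ x) y≡x))
        (𝟙-no (y ≟ y₀) (λ y≡y₀ → d≢0 (trans (sym (from-y₀ y≡y₀)) (trans (cong (λ t → f̂ x + f̂ t) y≡x) (x+x≡0 (f̂ x))))))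
      byCases (no y≢x) (yes chord≡d) = cong₂ ℕ._+_ (cong₂ ℕ._+_ (𝟙-no adm (λ (_ , chord≢d) → chord≢d chord≡d)) (𝟙-no (y ≟ x) y≢x))
        (𝟙-yes (y ≟ y₀) (to-y₀ chord≡d))
      byCases (no y≢x) (no chord≢d) = cong₂ ℕ._+_ (cong₂ ℕ._+_ (𝟙-yes adm ((y≢x ∘ sym) , chord≢d)) (𝟙-no (y ≟ x) y≢x))
        (𝟙-no (y ≟ y₀) (chord≢d ∘ from-y₀))

    total : ∑ (admissible x) ℕ.+ 2 ≡ q
    total = begin
      ∑ (admissible x) ℕ.+ 2
        ≡⟨ cong (∑ (admissible x) ℕ.+_) (sym (cong₂ ℕ._+_ (∑-delta x) (∑-delta y₀))) ⟩
      ∑ (admissible x) ℕ.+ (∑ (λ y → 𝟙 (y ≟ x)) ℕ.+ ∑ (λ y → 𝟙 (y ≟ y₀)))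
        ≡⟨ sym (ℕₚ.+-assoc (∑ (admissible x)) _ _) ⟩
      (∑ (admissible x) ℕ.+ ∑ (λ y → 𝟙 (y ≟ x))) ℕ.+ ∑ (λ y → 𝟙 (y ≟ y₀))
        ≡⟨ cong (ℕ._+ ∑ (λ y → 𝟙 (y ≟ y₀))) (sym (∑-distrib-+ (admissible x ∘ element) (λ l → 𝟙 (element l ≟ x)))) ⟩
      ∑ (λ y → admissible x y ℕ.+ 𝟙 (y ≟ x)) ℕ.+ ∑ (λ y → 𝟙 (y ≟ y₀))
        ≡⟨ sym (∑-distrib-+ (λ l → admissible x (element l) ℕ.+ 𝟙 (element l ≟ x)) (λ l → 𝟙 (element l ≟ y₀))) ⟩
      ∑ (λ y → (admissible x y ℕ.+ 𝟙 (y ≟ x)) ℕ.+ 𝟙 (y ≟ y₀))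
        ≡⟨ sum-cong-≗ (partition ∘ element) ⟩
      sum {q} (λ _ → 1)
        ≡⟨ trans (sum-const q 1) (ℕₚ.*-identityʳ q) ⟩
      q ∎

  four-Λ : 4 ℕ.* Λ ≡ q ℕ.* (q ℕ.∸ 2)
  four-Λ = begin
    4 ℕ.* Λ
      ≡⟨ *-distribˡ-sum 4 (λ l → ∑ (λ c → weight (element l) c)) ⟩
    ∑ (λ b → 4 ℕ.* ∑ (λ c → weight b c))
      ≡⟨ sum-cong-≗ (λ l → *-distribˡ-sum 4 (λ l′ → weight (element l) (element l′))) ⟩
    ∑ (λ b → ∑ (λ c → 4 ℕ.* weight b c))
      ≡⟨ sum-cong-≗ (λ l → sum-cong-≗ (λ l′ → four-memberships (element l) (element l′))) ⟩
    ∑ (λ b → ∑ (λ c → nonzero b ℕ.* (hits b c u ℕ.* hits b c v)))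
      ≡⟨ sum-cong-≗ (λ l → sym (*-distribˡ-sum (nonzero (element l)) (λ l′ → hits (element l) (element l′) u ℕ.* hits (element l) (element l′) v))) ⟩
    ∑ (λ b → nonzero b ℕ.* ∑ (λ c → hits b c u ℕ.* hits b c v))
      ≡⟨ sum-cong-≗ (λ l → cong (nonzero (element l) ℕ.*_) (∑-hits-product (element l))) ⟩
    ∑ (λ b → nonzero b ℕ.* ∑ (λ x → ∑ (λ y → chord b x y)))
      ≡⟨ sum-cong-≗ (λ l → trans (*-distribˡ-sum (nonzero (element l)) (λ p → ∑ (λ y → chord (element l) (element p) y)))
           (sum-cong-≗ (λ p → *-distribˡ-sum (nonzero (element l)) (λ p′ → chord (element l) (element p) (element p′))))) ⟩
    ∑ (λ b → ∑ (λ x → ∑ (λ y → nonzero b ℕ.* chord b x y)))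
      ≡⟨ ∑-comm (λ l p → ∑ (λ y → nonzero (element l) ℕ.* chord (element l) (element p) y)) ⟩
    ∑ (λ x → ∑ (λ b → ∑ (λ y → nonzero b ℕ.* chord b x y)))
      ≡⟨ sum-cong-≗ (λ p → ∑-comm (λ l p′ → nonzero (element l) ℕ.* chord (element l) (element p) (element p′))) ⟩
    ∑ (λ x → ∑ (λ y → ∑ (λ b → nonzero b ℕ.* chord b x y)))
      ≡⟨ sum-cong-≗ (λ p → sum-cong-≗ (λ p′ → ∑-slopes (element p) (element p′))) ⟩
    ∑ (λ x → ∑ (λ y → admissible x y))
      ≡⟨ sum-cong-≗ (λ p → ∑-admissible (element p)) ⟩
    sum {q} (λ _ → q ℕ.∸ 2)
      ≡⟨ sum-const q (q ℕ.∸ 2) ⟩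
    q ℕ.* (q ℕ.∸ 2) ∎
    where
    weight : Carrier → Carrier → ℕ
    weight b c = nonzero b ℕ.* (𝟙 (i ∈? block f b c) ℕ.* 𝟙 (j ∈? block f b c))

  Λ≡ : Λ ≡ (q ℕ.* (q ℕ.∸ 2)) ℕ./ 4
  Λ≡ = trans (sym (m*n/n≡m Λ 4)) (cong (ℕ._/ 4) (trans (ℕₚ.*-comm Λ 4) four-Λ))

module Design {m : ℕ} (m≥1 : m ℕ.≥ 1) (F : FiniteField (2 ℕ.^ m))
  (f : FiniteField.Poly F) (isOPoly : FiniteField.IsOPolynomial F f) where

  import Data.Nat.Properties as ℕₚ
  open import Level using (0ℓ)
  open import Data.Fin.Subset using (Subset; ∣_∣)
  open import Data.Fin.Subset.Properties using (_⊆?_; _∈?_)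
  open import Data.Bool.Properties using () renaming (_≟_ to _≟ᵇ_)
  open import Data.Vec.Properties using (≡-dec)
  open import Data.List using (List; length; filter; map; cartesianProduct)
  import Data.List.Properties as Listₚ
  import Data.List.Relation.Unary.All.Properties as Allₚ
  import Data.List.Relation.Unary.Unique.DecPropositional.Properties as Uniqueₚ
  open import Data.Product using (_,_; proj₁; proj₂)
  open import Relation.Nullary using (yes; no)
  open import Relation.Nullary.Decidable using (_×-dec_)
  open import Relation.Unary using (Pred; Decidable)
  open import Relation.Binary.PropositionalEquality
  open import Function using (_∘_; id)
  open Counting
  open Subsets
  open FieldFacts F
  open OPoly m≥1 F f isOPoly
  open Blocks m≥1 F f isOPoly
  open ≡-Reasoning

  candidates : List (Subset q)
  candidates = map (λ bc → block f (proj₁ bc) (proj₂ bc)) (cartesianProduct elems elems)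

  hasSize? : Decidable (λ (B : Subset q) → ∣ B ∣ ≡ k)
  hasSize? B = ∣ B ∣ ℕ.≟ k

  sized : List (Subset q)
  sized = filter hasSize? candidates

  count-candidates : ∀ {Q : Pred (Subset q) 0ℓ} (Q? : Decidable Q) →
    length (filter Q? candidates) ≡ ∑ (λ b → ∑ (λ c → 𝟙 (Q? (block f b c))))
  count-candidates Q? =
    trans (cong (λ xs → length (filter Q? (map (λ bc → block f (proj₁ bc) (proj₂ bc)) (cartesianProduct xs xs))))
                (Listₚ.map-tabulate id element))
          (length-filter-product Q? (λ bc → block f (proj₁ bc) (proj₂ bc)) element element)

  ∑-nonzero : ∑ nonzero ≡ q ℕ.∸ 1
  ∑-nonzero = trans (sym (ℕₚ.m+n∸n≡m (∑ nonzero) 1)) (cong (ℕ._∸ 1) (begin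
    ∑ nonzero ℕ.+ 1                               ≡⟨ cong (∑ nonzero ℕ.+_) (sym (∑-delta 0#)) ⟩
    ∑ nonzero ℕ.+ ∑ (λ b → 𝟙 (b ≟ 0#))            ≡⟨ sym (∑-distrib-+ (nonzero ∘ element) (λ l → 𝟙 (element l ≟ 0#))) ⟩
    ∑ (λ b → nonzero b ℕ.+ 𝟙 (b ≟ 0#))            ≡⟨ sum-cong-≗ (λ l → either (element l)) ⟩
    sum {q} (λ _ → 1)                             ≡⟨ trans (sum-const q 1) (ℕₚ.*-identityʳ q) ⟩
    q                                             ∎))
    where
    either : ∀ b → nonzero b ℕ.+ 𝟙 (b ≟ 0#) ≡ 1
    either b with b ≟ 0#
    ... | yes _ = refl
    ... | no _  = refl

  length-sized : length sized ≡ (q ℕ.∸ 1) ℕ.* q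
  length-sized = begin
    length sized                                ≡⟨ count-candidates hasSize? ⟩
    ∑ (λ b → ∑ (λ c → 𝟙 (hasSize? (block f b c)))) ≡⟨ sum-cong-≗ (λ l → sum-cong-≗ (λ l′ → 𝟙-∣block∣≡k (element l) (element l′))) ⟩
    ∑ (λ b → ∑ (λ c → nonzero b))               ≡⟨ sum-cong-≗ (λ l → sum-const q (nonzero (element l))) ⟩
    ∑ (λ b → q ℕ.* nonzero b)                   ≡⟨ sym (*-distribˡ-sum q (nonzero ∘ element)) ⟩
    q ℕ.* ∑ nonzero                             ≡⟨ cong (q ℕ.*_) ∑-nonzero ⟩
    q ℕ.* (q ℕ.∸ 1)                             ≡⟨ ℕₚ.*-comm q _ ⟩
    (q ℕ.∸ 1) ℕ.* q                             ∎

  -- The hypothesis on the number of blocks says deduplication removes nothing.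
  blocks≡sized : length (blocks f k) ≡ (q ℕ.∸ 1) ℕ.* q → blocks f k ≡ sized
  blocks≡sized hyp = deduplicate-complete (≡-dec _≟ᵇ_) sized (trans hyp (sym length-sized))

  pair-count : ∀ (T : Subset q) → ∣ T ∣ ≡ 2 → length (filter (T ⊆?_) sized) ≡ (q ℕ.* (q ℕ.∸ 2)) ℕ./ 4
  pair-count T ∣T∣≡2 with ∣∣≡2⇒pair T ∣T∣≡2
  ... | i , j , i≢j , i∈T , j∈T , only-ij = begin
    length (filter (T ⊆?_) sized)                                     ≡⟨ length-filter-filter hasSize? (T ⊆?_) candidates ⟩
    length (filter (λ B → hasSize? B ×-dec (T ⊆? B)) candidates)      ≡⟨ count-candidates (λ B → hasSize? B ×-dec (T ⊆? B)) ⟩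
    ∑ (λ b → ∑ (λ c → 𝟙 (hasSize? (block f b c) ×-dec (T ⊆? block f b c)))) ≡⟨ sum-cong-≗ (λ l → sum-cong-≗ (λ l′ → term (element l) (element l′))) ⟩
    PairCount.Λ m≥1 F f isOPoly i j i≢j                              ≡⟨ PairCount.Λ≡ m≥1 F f isOPoly i j i≢j ⟩
    (q ℕ.* (q ℕ.∸ 2)) ℕ./ 4                                           ∎
    where
    term : ∀ b c → 𝟙 (hasSize? (block f b c) ×-dec (T ⊆? block f b c)) ≡
                   nonzero b ℕ.* (𝟙 (i ∈? block f b c) ℕ.* 𝟙 (j ∈? block f b c))
    term b c = trans (𝟙-× (hasSize? (block f b c)) (T ⊆? block f b c))
                     (cong₂ ℕ._*_ (𝟙-∣block∣≡k b c) (𝟙-pair⊆ i∈T j∈T only-ij))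

  isDesign : length (blocks f k) ≡ (q ℕ.∸ 1) ℕ.* q → IsDesign 2 q k ((q ℕ.* (q ℕ.∸ 2)) ℕ./ 4) (blocks f k)
  isDesign hyp =
    Uniqueₚ.deduplicate-! (≡-dec _≟ᵇ_) sized ,
    Allₚ.deduplicate⁺ (≡-dec _≟ᵇ_) (Allₚ.all-filter hasSize? candidates) ,
    λ T ∣T∣≡2 → trans (cong (length ∘ filter (T ⊆?_)) (blocks≡sized hyp)) (pair-count T ∣T∣≡2)

open import Data.Nat using (ℕ; _^_; _*_; _∸_; _/_; _≥_)
open import Data.List using (length)
open import Relation.Binary.PropositionalEquality using (_≡_)

mainTheorem2 : (m : ℕ) → m ≥ 1 → (F : FiniteField (2 ^ m)) →
    (f : FiniteField.Poly F) → FiniteField.IsOPolynomial F f →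
    length (FiniteField.blocks F f ((2 ^ m) / 2)) ≡ ((2 ^ m) ∸ 1) * (2 ^ m) →
    IsDesign 2 (2 ^ m) ((2 ^ m) / 2) (((2 ^ m) * ((2 ^ m) ∸ 2)) / 4)
    (FiniteField.blocks F f ((2 ^ m) / 2))
mainTheorem2 m m≥1 F f isOPoly hyp = Design.isDesign m≥1 F f isOPoly hyp
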